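{- Let $S$ be a caterpillar sequence. Then for every integer $i\in\{3,4,\dots,|S|\}$, $S=\mathrm{Left}_i(S)\diamond\mathrm{Right}_{|S|+3-i}(S)$.
   Context: A caterpillar sequence is a finite sequence $S=(s_1,\dots,s_k)$, $k\ge1$, of non-negative integers with $s_1,s_k\ge1$, and $s_1\ge2$ if $k=1$; its size is $|S|=k+\sum_j s_j$. The graft of $S=(s_1,\dots,s_k)$ and $S'=(s'_1,\dots,s'_l)$ is $S\diamond S'=(s_1,\dots,s_{k-1},s_k+s'_1-2,s'_2,\dots,s'_l)$. For $3\le i\le|S|$: $\mathrm{Left}_i(S)=S$ if $i=|S|$; $\mathrm{Left}_i(S)=\mathrm{Left}_i(s_1,\dots,s_{k-1},s_k-1)$ if $i<|S|$, $s_k\ge2$; $\mathrm{Left}_i(S)=\mathrm{Left}_i(s_1,\dots,s_{k-2},s_{k-1}+1)$ if $i<|S|$, $s_k=1$. Symmetrically, $\mathrm{Right}_i(S)=S$ if $i=|S|$; $\mathrm{Right}_i(S)=\mathrm{Right}_i(s_1-1,s_2,\dots,s_k)$ if $i<|S|$, $s_1\ge2$; $\mathrm{Right}_i(S)=\mathrm{Right}_i(s_2+1,s_3,\dots,s_k)$ if $i<|S|$, $s_1=1$. -}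

module Defs where

open import Data.Nat using (ℕ; zero; suc; _+_; _∸_; _≤_)
open import Data.List using (List; []; _∷_; length)
open import Data.Nat.ListAction using (sum)
open import Data.Product using (_×_)
open import Data.Unit using (⊤)
open import Data.Empty using (⊥)

LastPos : List ℕ → Set
LastPos [] = ⊥
LastPos (x ∷ []) = 1 ≤ x
LastPos (x ∷ y ∷ xs) = LastPos (y ∷ xs)

IsCaterpillar : List ℕ → Set
IsCaterpillar [] = ⊥
IsCaterpillar (s ∷ []) = 2 ≤ s
IsCaterpillar (s ∷ t ∷ ts) = (1 ≤ s) × LastPos (t ∷ ts)

size : List ℕ → ℕ
size S = length S + sum S

-- graft  S ◇ S' = (s_1,…,s_{k-1}, s_k + s'_1 - 2, s'_2,…,s'_l)
-- (only used on non-empty lists; natural subtraction is exact there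
--  since s_k, s'_1 ≥ 1)
_◇_ : List ℕ → List ℕ → List ℕ
[] ◇ T = T
(s ∷ []) ◇ [] = s ∷ []
(s ∷ []) ◇ (t ∷ ts) = (s + t ∸ 2) ∷ ts
(s ∷ s' ∷ ss) ◇ T = s ∷ ((s' ∷ ss) ◇ T)

leftStep : List ℕ → List ℕ
leftStep [] = []
leftStep (s ∷ []) = (s ∸ 1) ∷ []
leftStep (s ∷ 1 ∷ []) = suc s ∷ []
leftStep (s ∷ t ∷ []) = s ∷ (t ∸ 1) ∷ []
leftStep (s ∷ t ∷ u ∷ us) = s ∷ leftStep (t ∷ u ∷ us)

rightStep : List ℕ → List ℕ
rightStep [] = []
rightStep (1 ∷ t ∷ ts) = suc t ∷ ts
rightStep (s ∷ ts) = (s ∸ 1) ∷ ts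

iter : (List ℕ → List ℕ) → ℕ → List ℕ → List ℕ
iter f zero S = S
iter f (suc n) S = iter f n (f S)

-- Each step lowers the size by exactly one, so the recursive definition of
-- Left_i(S) (stop when |S| = i) unfolds to applying the step |S| - i times.
Left : ℕ → List ℕ → List ℕ
Left i S = iter leftStep (size S ∸ i) S

Right : ℕ → List ℕ → List ℕ
Right i S = iter rightStep (size S ∸ i) S

-- A caterpillar sequence of size n + 3 is obtained from (2) by grafting, on the
-- left, a word of n letters, each letter being (3) or (1,1).  A right step
-- deletes the first letter and a left step the last one, while grafting
-- concatenates words.  So Left_i(S) is the prefix of length i − 3 of the word
-- of S, Right_{|S|+3−i}(S) is the complementary suffix, and their graft is S.
module Submission where

open import Defs
open import Data.List using (List; []; _∷_; length; _++_; take; drop)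
open import Data.List.Properties using (++-assoc; ++-identityʳ; length-take; length-drop; take++drop≡id)
open import Data.Nat using (ℕ; zero; suc; _+_; _∸_; _≤_; _⊓_; z≤n; s≤s)
open import Data.Nat.Properties
  using (+-comm; +-suc; +-cancelˡ-≤; ≤-trans; m≤n+m; m≤n⇒m⊓n≡m; m∸[m∸n]≡n)
open import Data.Product using (_,_)
open import Relation.Binary.PropositionalEquality

data Letter : Set where
  ⟨3⟩ ⟨1,1⟩ : Letter

piece : Letter → List ℕ
piece ⟨3⟩   = 3 ∷ []
piece ⟨1,1⟩ = 1 ∷ 1 ∷ []

decode : List Letter → List ℕ
decode []      = 2 ∷ []
decode (c ∷ w) = piece c ◇ decode w

piece-◇-isCaterpillar : ∀ c Y → IsCaterpillar Y → IsCaterpillar (piece c ◇ Y)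
piece-◇-isCaterpillar _     (suc zero ∷ [])     (s≤s ())
piece-◇-isCaterpillar ⟨3⟩   (suc (suc y) ∷ [])  _       = s≤s (s≤s z≤n)
piece-◇-isCaterpillar ⟨1,1⟩ (suc (suc y) ∷ [])  _       = s≤s z≤n , s≤s z≤n
piece-◇-isCaterpillar ⟨3⟩   (y ∷ y' ∷ ys)       (_ , p) = s≤s z≤n , p
piece-◇-isCaterpillar ⟨1,1⟩ (y ∷ y' ∷ ys)       (_ , p) = s≤s z≤n , p

decode-isCaterpillar : ∀ w → IsCaterpillar (decode w)
decode-isCaterpillar []      = s≤s (s≤s z≤n)
decode-isCaterpillar (c ∷ w) = piece-◇-isCaterpillar c (decode w) (decode-isCaterpillar w)

isCaterpillar⇒lastPos : ∀ X → IsCaterpillar X → LastPos X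
isCaterpillar⇒lastPos (x ∷ [])     (s≤s _) = s≤s z≤n
isCaterpillar⇒lastPos (x ∷ y ∷ ys) (_ , p) = p

◇-identityˡ : ∀ Y → IsCaterpillar Y → (2 ∷ []) ◇ Y ≡ Y
◇-identityˡ (y ∷ ys) _ = refl

piece-◇-assoc : ∀ c X T → IsCaterpillar X → piece c ◇ (X ◇ T) ≡ (piece c ◇ X) ◇ T
piece-◇-assoc _     (suc zero ∷ [])     T       (s≤s ())
piece-◇-assoc ⟨3⟩   (suc (suc x) ∷ []) []      _ = refl
piece-◇-assoc ⟨3⟩   (suc (suc x) ∷ []) (t ∷ T) _ = refl
piece-◇-assoc ⟨1,1⟩ (suc (suc x) ∷ []) []      _ = refl
piece-◇-assoc ⟨1,1⟩ (suc (suc x) ∷ []) (t ∷ T) _ = refl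
piece-◇-assoc ⟨3⟩   (x ∷ x' ∷ xs)      T       _ = refl
piece-◇-assoc ⟨1,1⟩ (x ∷ x' ∷ xs)      T       _ = refl

decode-++ : ∀ u v → decode (u ++ v) ≡ decode u ◇ decode v
decode-++ []      v = sym (◇-identityˡ (decode v) (decode-isCaterpillar v))
decode-++ (c ∷ u) v = begin
  piece c ◇ decode (u ++ v)         ≡⟨ cong (piece c ◇_) (decode-++ u v) ⟩
  piece c ◇ (decode u ◇ decode v)   ≡⟨ piece-◇-assoc c (decode u) (decode v) (decode-isCaterpillar u) ⟩
  (piece c ◇ decode u) ◇ decode v   ∎
  where open ≡-Reasoning

decode-[_] : ∀ c → decode (c ∷ []) ≡ piece c
decode-[ ⟨3⟩   ] = refl
decode-[ ⟨1,1⟩ ] = refl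

decode-∷ʳ : ∀ u c → decode (u ++ c ∷ []) ≡ decode u ◇ piece c
decode-∷ʳ u c = trans (decode-++ u (c ∷ [])) (cong (decode u ◇_) decode-[ c ])

size-piece-◇ : ∀ c Y → IsCaterpillar Y → size (piece c ◇ Y) ≡ suc (size Y)
size-piece-◇ _     (suc zero ∷ [])    (s≤s ())
size-piece-◇ ⟨3⟩   (suc (suc y) ∷ []) _ = refl
size-piece-◇ ⟨1,1⟩ (suc (suc y) ∷ []) _ = refl
size-piece-◇ ⟨3⟩   (suc y ∷ y' ∷ ys)  _ = +-suc (suc (suc (length ys))) (suc y + (y' + _))
size-piece-◇ ⟨1,1⟩ (suc y ∷ y' ∷ ys)  _ = refl

size-decode : ∀ w → size (decode w) ≡ 3 + length w
size-decode []      = refl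
size-decode (c ∷ w) =
  trans (size-piece-◇ c (decode w) (decode-isCaterpillar w)) (cong suc (size-decode w))

rightStep-piece-◇ : ∀ c Y → IsCaterpillar Y → rightStep (piece c ◇ Y) ≡ Y
rightStep-piece-◇ _     (suc zero ∷ [])    (s≤s ())
rightStep-piece-◇ ⟨3⟩   (suc (suc y) ∷ []) _ = refl
rightStep-piece-◇ ⟨1,1⟩ (suc (suc y) ∷ []) _ = refl
rightStep-piece-◇ ⟨3⟩   (suc y ∷ y' ∷ ys)  _ = refl
rightStep-piece-◇ ⟨1,1⟩ (suc y ∷ y' ∷ ys)  _ = refl

leftStep-∷ : ∀ x y z zs → leftStep (x ∷ y ∷ z ∷ zs) ≡ x ∷ leftStep (y ∷ z ∷ zs)
leftStep-∷ x zero          z zs = refl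
leftStep-∷ x (suc zero)    z zs = refl
leftStep-∷ x (suc (suc y)) z zs = refl

leftStep-◇-piece : ∀ c X → LastPos X → leftStep (X ◇ piece c) ≡ X
leftStep-◇-piece ⟨3⟩   (suc x ∷ [])       _ rewrite +-comm x 3 = refl
leftStep-◇-piece ⟨1,1⟩ (suc x ∷ [])       _ rewrite +-comm x 1 = refl
leftStep-◇-piece ⟨3⟩   (x ∷ suc y ∷ [])   _ rewrite +-comm y 3 = refl
leftStep-◇-piece ⟨1,1⟩ (x ∷ suc y ∷ [])   _ rewrite +-comm y 1 = leftStep-∷ x y 1 []
leftStep-◇-piece c     (x ∷ y ∷ z ∷ zs)   p
  with (z ∷ zs) ◇ piece c | leftStep-◇-piece c (y ∷ z ∷ zs) p
... | []       | ()
... | z' ∷ zs' | ih = trans (leftStep-∷ x y z' zs') (cong (x ∷_) ih)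

iter-suc : ∀ (f : List ℕ → List ℕ) n S → iter f (suc n) S ≡ f (iter f n S)
iter-suc f zero    S = refl
iter-suc f (suc n) S = iter-suc f n (f S)

iter-rightStep-decode : ∀ u v → iter rightStep (length u) (decode (u ++ v)) ≡ decode v
iter-rightStep-decode []      v = refl
iter-rightStep-decode (c ∷ u) v =
  trans (cong (iter rightStep (length u))
              (rightStep-piece-◇ c (decode (u ++ v)) (decode-isCaterpillar (u ++ v))))
        (iter-rightStep-decode u v)

iter-leftStep-decode : ∀ u v → iter leftStep (length v) (decode (u ++ v)) ≡ decode u
iter-leftStep-decode u []      = cong decode (++-identityʳ u)
iter-leftStep-decode u (c ∷ v) = begin
  iter leftStep (suc (length v)) (decode (u ++ c ∷ v))
    ≡⟨ iter-suc leftStep (length v) _ ⟩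
  leftStep (iter leftStep (length v) (decode (u ++ c ∷ v)))
    ≡⟨ cong (λ w → leftStep (iter leftStep (length v) (decode w))) (sym (++-assoc u (c ∷ []) v)) ⟩
  leftStep (iter leftStep (length v) (decode ((u ++ c ∷ []) ++ v)))
    ≡⟨ cong leftStep (iter-leftStep-decode (u ++ c ∷ []) v) ⟩
  leftStep (decode (u ++ c ∷ []))
    ≡⟨ cong leftStep (decode-∷ʳ u c) ⟩
  leftStep (decode u ◇ piece c)
    ≡⟨ leftStep-◇-piece c (decode u) (isCaterpillar⇒lastPos (decode u) (decode-isCaterpillar u)) ⟩
  decode u ∎
  where open ≡-Reasoning

-- The head is passed separately so that the recursion decreases
-- lexicographically in (tail, head); non-caterpillar inputs give junk.
encode : ℕ → List ℕ → List Letter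
encode (suc zero)          (t ∷ ts) = ⟨1,1⟩ ∷ encode (suc t) ts
encode (suc (suc s))       (t ∷ ts) = ⟨3⟩ ∷ encode (suc s) (t ∷ ts)
encode (suc (suc zero))    []       = []
encode (suc (suc (suc s))) []       = ⟨3⟩ ∷ encode (suc (suc s)) []
encode _                   _        = []

decode-encode : ∀ s ts → IsCaterpillar (s ∷ ts) → decode (encode s ts) ≡ s ∷ ts
decode-encode (suc zero)          []            (s≤s ())
decode-encode (suc (suc zero))    []            _       = refl
decode-encode (suc (suc (suc s))) []            _       =
  cong (piece ⟨3⟩ ◇_) (decode-encode (suc (suc s)) [] (s≤s (s≤s z≤n)))
decode-encode (suc (suc s))       (t ∷ ts)      (_ , p) =
  cong (piece ⟨3⟩ ◇_) (decode-encode (suc s) (t ∷ ts) (s≤s z≤n , p))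
decode-encode (suc zero)          (suc t ∷ [])  _       =
  cong (piece ⟨1,1⟩ ◇_) (decode-encode (suc (suc t)) [] (s≤s (s≤s z≤n)))
decode-encode (suc zero)          (t ∷ u ∷ us)  (_ , p) =
  cong (piece ⟨1,1⟩ ◇_) (decode-encode (suc t) (u ∷ us) (s≤s z≤n , p))

SplitsAsGraft : List ℕ → Set
SplitsAsGraft S = (i : ℕ) → 3 ≤ i → i ≤ size S → S ≡ Left i S ◇ Right (size S + 3 ∸ i) S

decode-splitsAsGraft : ∀ w → SplitsAsGraft (decode w)
decode-splitsAsGraft w (suc (suc (suc j))) (s≤s (s≤s (s≤s _))) i≤size = begin
  decode w                    ≡⟨ cong decode w≡u++v ⟩
  decode (u ++ v)             ≡⟨ decode-++ u v ⟩
  decode u ◇ decode v         ≡⟨ cong₂ _◇_ (sym Left≡decode-prefix) (sym Right≡decode-suffix) ⟩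
  Left i (decode w) ◇ Right (m + 3 ∸ i) (decode w) ∎
  where
  open ≡-Reasoning
  i m : ℕ
  i = 3 + j
  m = size (decode w)
  u v : List Letter
  u = take j w
  v = drop j w
  w≡u++v : w ≡ u ++ v
  w≡u++v = sym (take++drop≡id j w)
  j≤n : j ≤ length w
  j≤n = +-cancelˡ-≤ 3 j (length w) (subst (i ≤_) (size-decode w) i≤size)
  left-count : m ∸ i ≡ length v
  left-count = trans (cong (_∸ i) (size-decode w)) (sym (length-drop j w))
  right-count : m ∸ (m + 3 ∸ i) ≡ length u
  right-count = begin
    m ∸ (m + 3 ∸ i)   ≡⟨ cong (λ k → m ∸ (k ∸ i)) (+-comm m 3) ⟩
    m ∸ (m ∸ j)       ≡⟨ m∸[m∸n]≡n (≤-trans (m≤n+m j 3) i≤size) ⟩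
    j                 ≡⟨ sym (m≤n⇒m⊓n≡m j≤n) ⟩
    j ⊓ length w      ≡⟨ sym (length-take j w) ⟩
    length u          ∎
  Left≡decode-prefix : Left i (decode w) ≡ decode u
  Left≡decode-prefix =
    trans (cong₂ (iter leftStep) left-count (cong decode w≡u++v)) (iter-leftStep-decode u v)
  Right≡decode-suffix : Right (m + 3 ∸ i) (decode w) ≡ decode v
  Right≡decode-suffix =
    trans (cong₂ (iter rightStep) right-count (cong decode w≡u++v)) (iter-rightStep-decode u v)

lemma5 : (S : List ℕ) → IsCaterpillar S → (i : ℕ) → 3 ≤ i → i ≤ size S →
    S ≡ Left i S ◇ Right (size S + 3 ∸ i) S
lemma5 (s ∷ ts) isCat = subst SplitsAsGraft (decode-encode s ts isCat) (decode-splitsAsGraft (encode s ts))
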